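{- If $n\ge 2$ and $\Gamma_1,\dots,\Gamma_n$ are minimal prime graphs, then $\overline{\times}_{i=1}^{n}\Gamma_i$ is not a minimal prime graph.
   Context: All graphs are finite, simple and undirected; $\overline{G}$ is the complement of $G$. The direct product $G\times H$ has vertex set $V(G)\times V(H)$, with $\{(u,v),(u',v')\}$ an edge iff $\{u,u'\}\in E(G)$ and $\{v,v'\}\in E(H)$. The complementary direct product is $G\,\overline{\times}\,H=\overline{\overline{G}\times\overline{H}}$, iterated as $\overline{\times}_{i=1}^{n}\Gamma_i=(\overline{\times}_{i=1}^{n-1}\Gamma_i)\,\overline{\times}\,\Gamma_n$. A minimal prime graph is a connected graph $\Gamma$ on two or more vertices such that (1) $\overline{\Gamma}$ is triangle-free, (2) $\overline{\Gamma}$ is 3-colorable, and (3) for every edge $e$ of $\Gamma$, the complement of the graph obtained from $\Gamma$ by deleting $e$ is not both triangle-free and 3-colorable. -}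

module Defs where

open import Data.Nat using (ℕ; zero; suc; _*_; _≤_)
open import Data.Fin using (Fin; zero; suc; remQuot; inject₁; fromℕ; _≟_)
open import Data.Bool using (Bool; true; false; _∧_; _∨_; not)
open import Data.Bool.Properties using (∧-zeroʳ; ∧-zeroˡ)
open import Data.Product using (Σ; _×_; _,_; proj₁; proj₂; ∃)
open import Data.Empty using (⊥; ⊥-elim)
open import Relation.Nullary using (¬_; yes; no)
open import Relation.Nullary.Decidable using (⌊_⌋)
open import Relation.Binary.PropositionalEquality
  using (_≡_; _≢_; refl; cong; cong₂; trans)
  renaming (sym to ≡-sym)

record Graph : Set where
  field
    n          : ℕ
    adj        : Fin n → Fin n → Bool
    adj-sym    : ∀ u v → adj u v ≡ adj v u
    adj-irrefl : ∀ u → adj u u ≡ false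
open Graph public

_==_ : ∀ {m} → Fin m → Fin m → Bool
u == v = ⌊ u ≟ v ⌋

==-sym : ∀ {m} (u v : Fin m) → (u == v) ≡ (v == u)
==-sym u v with u ≟ v | v ≟ u
... | yes _ | yes _ = refl
... | no _  | no _  = refl
... | yes p | no ¬q = ⊥-elim (¬q (≡-sym p))
... | no ¬p | yes q = ⊥-elim (¬p (≡-sym q))

==-refl : ∀ {m} (u : Fin m) → (u == u) ≡ true
==-refl u with u ≟ u
... | yes _ = refl
... | no ¬p = ⊥-elim (¬p refl)

complement : Graph → Graph
complement G = record
  { n          = n G
  ; adj        = λ u v → not (adj G u v) ∧ not (u == v)
  ; adj-sym    = λ u v → cong₂ (λ a b → not a ∧ not b) (adj-sym G u v) (==-sym u v)
  ; adj-irrefl = λ u → trans (cong (λ b → not (adj G u u) ∧ not b) (==-refl u))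
                             (∧-zeroʳ (not (adj G u u)))
  }

-- Direct (tensor) product; vertex set Fin (n G * n H) ≅ Fin (n G) × Fin (n H)
-- via Data.Fin.remQuot / combine.
_×ᵍ_ : Graph → Graph → Graph
G ×ᵍ H = record
  { n          = n G * n H
  ; adj        = λ p q → adjP (remQuot (n H) p) (remQuot (n H) q)
  ; adj-sym    = λ p q → symP (remQuot (n H) p) (remQuot (n H) q)
  ; adj-irrefl = λ p → irrP (remQuot (n H) p)
  }
  where
  adjP : Fin (n G) × Fin (n H) → Fin (n G) × Fin (n H) → Bool
  adjP (u , v) (u' , v') = adj G u u' ∧ adj H v v'
  symP : ∀ x y → adjP x y ≡ adjP y x
  symP (u , v) (u' , v') = cong₂ _∧_ (adj-sym G u u') (adj-sym H v v')
  irrP : ∀ x → adjP x x ≡ false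
  irrP (u , v) = trans (cong (_∧ adj H v v) (adj-irrefl G u)) (∧-zeroˡ (adj H v v))

_×̄_ : Graph → Graph → Graph
G ×̄ H = complement (complement G ×ᵍ complement H)

-- Iterated complementary direct product of Γ₀, …, Γ_k (k+1 factors):
-- ×̄_{i=0}^{k} Γ_i = (×̄_{i=0}^{k-1} Γ_i) ×̄ Γ_k
iterProd : (k : ℕ) → (Fin (suc k) → Graph) → Graph
iterProd zero    Γ = Γ zero
iterProd (suc k) Γ = iterProd k (λ i → Γ (inject₁ i)) ×̄ Γ (fromℕ (suc k))

data Reach (G : Graph) : Fin (n G) → Fin (n G) → Set where
  here : ∀ {u} → Reach G u u
  step : ∀ {u w v} → adj G u w ≡ true → Reach G w v → Reach G u v

Connected : Graph → Set
Connected G = ∀ u v → Reach G u v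

TriangleFree : Graph → Set
TriangleFree G = ∀ a b c → adj G a b ≡ true → adj G b c ≡ true → adj G a c ≡ true → ⊥

ThreeColorable : Graph → Set
ThreeColorable G = Σ (Fin (n G) → Fin 3) λ col → ∀ u v → adj G u v ≡ true → col u ≢ col v

deleteEdge : (G : Graph) (a b : Fin (n G)) → Graph
deleteEdge G a b = record
  { n          = n G
  ; adj        = λ u v → adj G u v ∧ not (((u == a) ∧ (v == b)) ∨ ((u == b) ∧ (v == a)))
  ; adj-sym    = λ u v → cong₂ (λ x y → x ∧ not y) (adj-sym G u v) (flip u v)
  ; adj-irrefl = λ u → trans (cong (_∧ not (((u == a) ∧ (u == b)) ∨ ((u == b) ∧ (u == a)))) (adj-irrefl G u)) (∧-zeroˡ (not (((u == a) ∧ (u == b)) ∨ ((u == b) ∧ (u == a)))))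
  }
  where
  open import Data.Bool.Properties using (∨-comm)
  flip : ∀ u v → (((u == a) ∧ (v == b)) ∨ ((u == b) ∧ (v == a)))
               ≡ (((v == a) ∧ (u == b)) ∨ ((v == b) ∧ (u == a)))
  flip u v rewrite Data.Bool.Properties.∧-comm (u == a) (v == b)
                 | Data.Bool.Properties.∧-comm (u == b) (v == a)
                 = ∨-comm ((v == b) ∧ (u == a)) ((v == a) ∧ (u == b))
    where import Data.Bool.Properties

record MinimalPrime (Γ : Graph) : Set where
  field
    twoOrMore  : 2 ≤ n Γ
    connected  : Connected Γ
    compTF     : TriangleFree (complement Γ)
    comp3Col   : ThreeColorable (complement Γ)
    minimal    : ∀ a b → adj Γ a b ≡ true →
                 ¬ (TriangleFree (complement (deleteEdge Γ a b))
                    × ThreeColorable (complement (deleteEdge Γ a b)))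

{-# OPTIONS --safe #-}

-- The complement of Γ₁ ×̄ ⋯ ×̄ Γₙ is the direct product of the complements, so
-- for A ×̄ B it projects homomorphically onto the complement of B. A minimal
-- prime B is not complete (else deleting any edge leaves a complement that maps
-- to K₂), so its complement has an edge bb′. For any vertex a of A the vertices
-- (a,b) and (a,b′) are adjacent in A ×̄ B, and deleting that edge only adds an
-- edge to the complement that still projects onto bb′. The new complement thus
-- maps to the complement of B, hence stays triangle-free and 3-colourable,
-- contradicting minimality of A ×̄ B.
module Submission where

open import Defs
open import Data.Nat using (ℕ; suc; _≤_; s≤s)
open import Data.Fin using (Fin; zero; suc; combine; remQuot; inject₁; fromℕ; _≟_)
open import Data.Fin.Properties using (remQuot-combine; combine-injectiveʳ; inject₁-injective)
open import Data.Bool using (Bool; true; false; not; _∧_; _∨_; if_then_else_)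
open import Data.Product using (_×_; _,_; proj₁; proj₂; ∃₂)
open import Data.Sum using (_⊎_; inj₁; inj₂)
open import Data.Bool.Properties using (not-injective)
open import Data.Empty using (⊥-elim)
open import Function using (_∘_)
open import Relation.Nullary using (¬_; yes; no; contradiction)
open import Relation.Binary.PropositionalEquality
  using (_≡_; _≢_; refl; sym; trans; cong; cong₂; subst₂; module ≡-Reasoning)

record Hom (G H : Graph) : Set where
  field
    map     : Fin (n G) → Fin (n H)
    map-adj : ∀ {u v} → adj G u v ≡ true → adj H (map u) (map v) ≡ true
open Hom public

_∘ʰ_ : ∀ {G H K} → Hom H K → Hom G H → Hom G K
ψ ∘ʰ φ = record { map = map ψ ∘ map φ ; map-adj = map-adj ψ ∘ map-adj φ }

triangleFree-pullback : ∀ {G H} → Hom G H → TriangleFree H → TriangleFree G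
triangleFree-pullback φ tf a b c ab bc ac =
  tf (map φ a) (map φ b) (map φ c) (map-adj φ ab) (map-adj φ bc) (map-adj φ ac)

threeColorable-pullback : ∀ {G H} → Hom G H → ThreeColorable H → ThreeColorable G
threeColorable-pullback φ (col , proper) =
  col ∘ map φ , λ u v uv → proper (map φ u) (map φ v) (map-adj φ uv)

Edgeless : Graph → Set
Edgeless G = ∀ u v → adj G u v ≢ true

distinctVertices : ∀ {m} → 2 ≤ m → ∃₂ λ (u v : Fin m) → u ≢ v
distinctVertices (s≤s (s≤s _)) = zero , suc zero , λ ()

≢⇒==-false : ∀ {m} {u v : Fin m} → u ≢ v → (u == v) ≡ false
≢⇒==-false {u = u} {v} u≢v with u ≟ v
... | yes u≡v = contradiction u≡v u≢v
... | no _    = refl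

adj⇒≢ : ∀ G {u v} → adj G u v ≡ true → u ≢ v
adj⇒≢ G {u} uv refl with () ← trans (sym uv) (adj-irrefl G u)

SameEdge : ∀ {m} (a b u v : Fin m) → Set
SameEdge a b u v = (u ≡ a × v ≡ b) ⊎ (u ≡ b × v ≡ a)

complement-adj⁺ : ∀ G {u v} → adj G u v ≡ false → u ≢ v → adj (complement G) u v ≡ true
complement-adj⁺ G uv u≢v rewrite uv | ≢⇒==-false u≢v = refl

complement-adj⁻ : ∀ G {u v} → adj (complement G) u v ≡ true → adj G u v ≡ false × u ≢ v
complement-adj⁻ G {u} {v} uv with adj G u v | u ≟ v
... | false | no u≢v = refl , u≢v
... | false | yes _  with () ← uv
... | true  | _      with () ← uv

complement²-hom : ∀ G → Hom (complement (complement G)) G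
complement²-hom G = record { map = λ u → u ; map-adj = complement²-adj }
  where
  complement²-adj : ∀ {u v} → adj (complement (complement G)) u v ≡ true → adj G u v ≡ true
  complement²-adj {u} {v} uv with complement-adj⁻ (complement G) uv
  ... | ¬uv , u≢v with adj G u v | u == v | ≢⇒==-false u≢v
  ...   | true  | _ | _    = refl
  ...   | false | _ | refl with () ← ¬uv

sameEdge-decode : ∀ {m} {a b u v : Fin m} →
                  ((u == a) ∧ (v == b) ∨ (u == b) ∧ (v == a)) ≡ true → SameEdge a b u v
sameEdge-decode {a = a} {b} {u} {v} h with u ≟ a | v ≟ b | u ≟ b | v ≟ a
... | yes p | yes q | _     | _     = inj₁ (p , q)
... | yes _ | no _  | yes p | yes q = inj₂ (p , q)
... | no _  | _     | yes p | yes q = inj₂ (p , q)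
... | yes _ | no _  | yes _ | no _  with () ← h
... | yes _ | no _  | no _  | _     with () ← h
... | no _  | _     | yes _ | no _  with () ← h
... | no _  | _     | no _  | _     with () ← h

complement-deleteEdge-adj : ∀ G {a b u v} → adj (complement (deleteEdge G a b)) u v ≡ true →
                            adj (complement G) u v ≡ true ⊎ SameEdge a b u v
complement-deleteEdge-adj G {u = u} {v} uv with complement-adj⁻ (deleteEdge G _ _) uv
... | ¬uv , u≢v with adj G u v
...   | false = inj₁ (cong not (≢⇒==-false u≢v))
...   | true  = inj₂ (sameEdge-decode (not-injective ¬uv))

complement-deleteEdge-hom : ∀ G {H a b} (φ : Hom (complement G) H) → adj H (map φ a) (map φ b) ≡ true →
                            Hom (complement (deleteEdge G a b)) H
complement-deleteEdge-hom G {H} φ ab = record { map = map φ ; map-adj = map-adj′ }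
  where
  map-adj′ : ∀ {u v} → adj (complement (deleteEdge G _ _)) u v ≡ true → adj H (map φ u) (map φ v) ≡ true
  map-adj′ uv with complement-deleteEdge-adj G uv
  ... | inj₁ uv′                  = map-adj φ uv′
  ... | inj₂ (inj₁ (refl , refl)) = ab
  ... | inj₂ (inj₂ (refl , refl)) = trans (adj-sym H _ _) ab

edgeless-complement⇒adj : ∀ G → Edgeless (complement G) → ∀ {u v} → u ≢ v → adj G u v ≡ true
edgeless-complement⇒adj G edgeless {u} {v} u≢v with adj G u v in e
... | true  = refl
... | false = ⊥-elim (edgeless u v (complement-adj⁺ G e u≢v))

K₂ : Graph
K₂ = record
  { n          = 2
  ; adj        = λ i j → not (i == j)
  ; adj-sym    = λ i j → cong not (==-sym i j)
  ; adj-irrefl = λ i → cong not (==-refl i)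
  }

K₂-triangleFree : TriangleFree K₂
K₂-triangleFree zero       zero       _          () _  _
K₂-triangleFree (suc zero) (suc zero) _          () _  _
K₂-triangleFree zero       (suc zero) zero       _  _  ()
K₂-triangleFree zero       (suc zero) (suc zero) _  () _
K₂-triangleFree (suc zero) zero       zero       _  () _
K₂-triangleFree (suc zero) zero       (suc zero) _  _  ()

K₂-threeColorable : ThreeColorable K₂
K₂-threeColorable = inject₁ , λ i j ij → adj⇒≢ K₂ ij ∘ inject₁-injective

minimalPrime⇒¬edgeless-complement : ∀ {Γ} → MinimalPrime Γ → ¬ Edgeless (complement Γ)
minimalPrime⇒¬edgeless-complement {Γ} mp edgeless =
  minimal u v (edgeless-complement⇒adj Γ edgeless u≢v)
    (triangleFree-pullback φ K₂-triangleFree , threeColorable-pullback φ K₂-threeColorable)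
  where
  open MinimalPrime mp
  u v : Fin (n Γ)
  u = proj₁ (distinctVertices twoOrMore)
  v = proj₁ (proj₂ (distinctVertices twoOrMore))
  u≢v : u ≢ v
  u≢v = proj₂ (proj₂ (distinctVertices twoOrMore))
  χ : Hom (complement Γ) K₂
  χ = record
    { map     = λ x → if x == u then zero else suc zero
    ; map-adj = λ {a} {b} ab → ⊥-elim (edgeless a b ab)
    }
  χu-χv : adj K₂ (map χ u) (map χ v) ≡ true
  χu-χv rewrite ==-refl u | ≢⇒==-false (u≢v ∘ sym) = refl
  φ : Hom (complement (deleteEdge Γ u v)) K₂
  φ = complement-deleteEdge-hom Γ χ χu-χv

projʳ : ∀ G H → Fin (n (G ×ᵍ H)) → Fin (n H)
projʳ G H p = proj₂ (remQuot {n G} (n H) p)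

projʳ-combine : ∀ G H (u : Fin (n G)) (v : Fin (n H)) → projʳ G H (combine u v) ≡ v
projʳ-combine G H u v = cong proj₂ (remQuot-combine u v)

projʳ-hom : ∀ G H → Hom (G ×ᵍ H) H
projʳ-hom G H = record { map = projʳ G H ; map-adj = map-adj′ }
  where
  map-adj′ : ∀ {p q} → adj (G ×ᵍ H) p q ≡ true → adj H (projʳ G H p) (projʳ G H q) ≡ true
  map-adj′ {p} {q} pq with adj G (proj₁ (remQuot (n H) p)) (proj₁ (remQuot (n H) q))
  ... | true  = pq
  ... | false with () ← pq

×ᵍ-adj-sameˡ : ∀ G H (u : Fin (n G)) (v v′ : Fin (n H)) → adj (G ×ᵍ H) (combine u v) (combine u v′) ≡ false
×ᵍ-adj-sameˡ G H u v v′ = begin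
  adj (G ×ᵍ H) (combine u v) (combine u v′) ≡⟨ cong₂ adjPair (remQuot-combine u v) (remQuot-combine u v′) ⟩
  adj G u u ∧ adj H v v′                    ≡⟨ cong (_∧ adj H v v′) (adj-irrefl G u) ⟩
  false                                     ∎
  where
  open ≡-Reasoning
  adjPair : Fin (n G) × Fin (n H) → Fin (n G) × Fin (n H) → Bool
  adjPair (u , v) (u′ , v′) = adj G u u′ ∧ adj H v v′

×̄-notMinimalPrime : ∀ A B {b b′} → adj (complement B) b b′ ≡ true →
                    TriangleFree (complement B) → ThreeColorable (complement B) → ¬ MinimalPrime (A ×̄ B)
×̄-notMinimalPrime A B {b} {b′} bb′ tf col mp =
  minimal x y xy (triangleFree-pullback φ tf , threeColorable-pullback φ col)
  where
  open MinimalPrime mp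
  a : Fin (n A)
  a = proj₁ (remQuot (n B) (proj₁ (distinctVertices twoOrMore)))
  x y : Fin (n (A ×̄ B))
  x = combine a b
  y = combine a b′
  xy : adj (A ×̄ B) x y ≡ true
  xy = complement-adj⁺ (complement A ×ᵍ complement B)
         (×ᵍ-adj-sameˡ (complement A) (complement B) a b b′)
         (adj⇒≢ (complement B) bb′ ∘ combine-injectiveʳ a b a b′)
  π : Hom (complement (A ×̄ B)) (complement B)
  π = projʳ-hom (complement A) (complement B) ∘ʰ complement²-hom _
  πx-πy : adj (complement B) (map π x) (map π y) ≡ true
  πx-πy = subst₂ (λ p q → adj (complement B) p q ≡ true)
            (sym (projʳ-combine (complement A) (complement B) a b))
            (sym (projʳ-combine (complement A) (complement B) a b′)) bb′
  φ : Hom (complement (deleteEdge (A ×̄ B) x y)) (complement B)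
  φ = complement-deleteEdge-hom (A ×̄ B) π πx-πy

mainTheorem13 : (k : ℕ) (Γ : Fin (suc (suc k)) → Graph) →
                (∀ i → MinimalPrime (Γ i)) →
                ¬ MinimalPrime (iterProd (suc k) Γ)
mainTheorem13 k Γ mp prod =
  minimalPrime⇒¬edgeless-complement mpB λ b b′ bb′ →
    ×̄-notMinimalPrime (iterProd k (Γ ∘ inject₁)) B bb′ compTF comp3Col prod
  where
  B : Graph
  B = Γ (fromℕ (suc k))
  mpB : MinimalPrime B
  mpB = mp (fromℕ (suc k))
  open MinimalPrime mpB
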